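{- Let $w\in S_n$. Then the number of occurrences of $s_2$ in the $S$ canonical presentation of $w$ equals the number of almost-left-to-right minima of $w^{ -1}$, and also equals the number of almost-left-to-right minima of $w$, where these may be counted under either of the conventions (a) or (b) below.
   Context: For $u=[b_1,\dots,b_n]\in S_n$ (one-line notation), a position $i$ is an almost-left-to-right minimum if $|\{1\le j\le i: b_j<b_i\}|\le 1$ and additionally, under convention (a), $i\notin\{1,2\}$, or, under convention (b), $b_i\notin\{1,2\}$. Permutations are multiplied as functions; $s_i=(i,i+1)$; $R^S_j=\{1,s_j,s_js_{j-1},\dots,s_j\cdots s_1\}$ ($1\le j\le n-1$); every $w\in S_n$ factors uniquely as $w=w_1\cdots w_{n-1}$ with $w_j\in R^S_j$ (the $S$ canonical presentation), and occurrences of $s_2$ are counted in this word. -}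

module Defs where

open import Data.Nat using (ℕ; zero; suc; pred; _∸_; _≤_; _<_; _≤?_; _<?_; _≟_)
open import Data.Fin using (Fin; toℕ)
open import Data.Fin.Permutation using (Permutation′; _⟨$⟩ʳ_; _⟨$⟩ˡ_)
open import Data.List using (List; []; _∷_; length; filter; concatMap; allFin)
open import Data.Product using (_×_)
open import Relation.Nullary using (yes; no)
open import Relation.Nullary.Decidable using (_×-dec_)
open import Relation.Binary.PropositionalEquality using (_≡_)

-- Values of permutations are handled 1-based on ℕ: position/value i ∈ {1,…,n}
-- corresponds to the element (i-1) of Fin n.

sAct : ℕ → ℕ → ℕ
sAct a x with x ≟ a
... | yes _ = suc a
... | no _ with x ≟ suc a
...   | yes _ = a
...   | no _ = x

-- A word in the generators: [a₁,…,a_m] stands for s_{a₁} s_{a₂} ⋯ s_{a_m}.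
-- Its value as a function (product = composition of functions):
-- (s_{a₁} ⋯ s_{a_m})(x) = s_{a₁}(⋯(s_{a_m}(x))).
evalWord : List ℕ → ℕ → ℕ
evalWord [] x = x
evalWord (a ∷ as) x = sAct a (evalWord as x)

-- The element s_j s_{j-1} ⋯ s_{j-k+1} of R^S_j (k factors, 0 ≤ k ≤ j), as a word.
seg : ℕ → ℕ → List ℕ
seg j zero = []
seg j (suc k) = j ∷ seg (j ∸ 1) k

-- A choice of w_j ∈ R^S_j for each j = 1,…,n-1: index jf : Fin (n-1) stands
-- for j = toℕ jf + 1, and the chosen element is the one with k = toℕ (f jf)
-- factors, k ∈ {0,…,j}.
Factorization : ℕ → Set
Factorization n = (jf : Fin (pred n)) → Fin (suc (suc (toℕ jf)))

factWord : (n : ℕ) → Factorization n → List ℕ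
factWord n f = concatMap (λ jf → seg (suc (toℕ jf)) (toℕ (f jf))) (allFin (pred n))

Represents : (n : ℕ) → Factorization n → Permutation′ n → Set
Represents n f w = ∀ (x : Fin n) → evalWord (factWord n f) (suc (toℕ x)) ≡ suc (toℕ (w ⟨$⟩ʳ x))

occurrences : ℕ → List ℕ → ℕ
occurrences a ws = length (filter (λ b → b ≟ a) ws)

smallerBefore : {n : ℕ} → (Fin n → Fin n) → Fin n → ℕ
smallerBefore {n} u i =
  length (filter (λ j → (toℕ j ≤? toℕ i) ×-dec (toℕ (u j) <? toℕ (u i))) (allFin n))

-- Number of almost-left-to-right minima, convention (a): position i ∉ {1,2},
-- i.e. the 0-based index is ≥ 2.
almLRminA : {n : ℕ} → (Fin n → Fin n) → ℕ
almLRminA {n} u =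
  length (filter (λ i → (smallerBefore u i ≤? 1) ×-dec (2 ≤? toℕ i)) (allFin n))

-- Convention (b): value b_i ∉ {1,2}, i.e. the 0-based value is ≥ 2.
almLRminB : {n : ℕ} → (Fin n → Fin n) → ℕ
almLRminB {n} u =
  length (filter (λ i → (smallerBefore u i ≤? 1) ×-dec (2 ≤? toℕ (u i))) (allFin n))

-- Appending w_{m+1} = s_{m+1} ⋯ s_{m+2-k} to w_1 ⋯ w_m changes the one-line notation of the
-- inverse by appending the value m+2-k and shifting the old values order-preservingly around it.
-- So earlier positions keep their number of smaller predecessors, while the new last position has
-- exactly m+1-k of them: it is an almost-left-to-right minimum (convention (a)) exactly when w_{m+1}
-- contains s_2. The other three counts follow by symmetry: the pairs j ≤ i with u j < u i correspond
-- to those of u⁻¹ with positions and values exchanged, which swaps conventions (a) and (b); and since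
-- positions 1 and 2 always count, convention (a) gives the same number for u and u⁻¹.

module Submission where

open import Data.Bool.Base using (Bool; true; false; _∧_)
open import Data.Bool.Properties using (∧-identityʳ)
open import Data.Fin using (Fin; toℕ; fromℕ; fromℕ<; inject₁; punchIn; punchOut)
  renaming (zero to fzero; suc to fsuc; _≟_ to _≟ᶠ_)
open import Data.Fin.Permutation using (Permutation′; _⟨$⟩ʳ_; _⟨$⟩ˡ_; inverseˡ; inverseʳ; flip; remove; punchIn-permute′)
open import Data.Fin.Properties using (toℕ-injective; toℕ<n; toℕ-fromℕ<; fromℕ<-toℕ; toℕ-inject₁; toℕ-fromℕ; punchIn-punchOut)
open import Data.List.Base using (List; []; _∷_; _++_; length; filter; concat; tabulate; allFin)
open import Data.List.Properties using (length-++; filter-++; map-tabulate; ++-assoc; ++-identityʳ)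
open import Data.Nat using (ℕ; zero; suc; _+_; _∸_; _⊓_; _≤_; _<_; _≤?_; _<?_; _≟_; z≤n; s≤s; s<s; s<s⁻¹; s≤s⁻¹)
open import Data.Nat.Properties
open import Algebra.Properties.CommutativeMonoid.Sum +-0-commutativeMonoid
  using (sum; sum-cong-≗; sum-permute)
open import Data.Empty using (⊥-elim)
open import Data.Product.Base using (_×_; _,_; proj₁; proj₂; ∃; ∃-syntax)
open import Data.Sum.Base using (inj₁; inj₂)
open import Function.Base using (_∘_; id)
open import Function.Bundles using (mk⇔)
open import Relation.Binary.PropositionalEquality
open import Relation.Nullary using (Dec; yes; no; does)
open import Relation.Nullary.Decidable using (dec-true; dec-false; does-⇔; _×-dec_)
open import Relation.Unary using (Pred; Decidable)

open import Defs

fromBool : Bool → ℕ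
fromBool false = 0
fromBool true  = 1

fromBool-≤1 : ∀ b → fromBool b ≤ 1
fromBool-≤1 false = z≤n
fromBool-≤1 true  = ≤-refl

count : (ℕ → Bool) → ℕ → ℕ
count p zero    = 0
count p (suc n) = count p n + fromBool (p n)

count-cong : ∀ {p q : ℕ → Bool} n → (∀ i → i < n → p i ≡ q i) → count p n ≡ count q n
count-cong zero    eq = refl
count-cong (suc n) eq =
  cong₂ _+_ (count-cong n (λ i i<n → eq i (m<n⇒m<1+n i<n))) (cong fromBool (eq n ≤-refl))

count-≤ : ∀ p n → count p n ≤ n
count-≤ p zero    = z≤n
count-≤ p (suc n) = ≤-trans (+-mono-≤ (count-≤ p n) (fromBool-≤1 (p n))) (≤-reflexive (+-comm n 1))

count-suc-front : ∀ p n → count p (suc n) ≡ fromBool (p 0) + count (p ∘ suc) n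
count-suc-front p zero    = +-comm 0 (fromBool (p 0))
count-suc-front p (suc n) = begin
  count p (suc n) + fromBool (p (suc n))                 ≡⟨ cong (_+ fromBool (p (suc n))) (count-suc-front p n) ⟩
  fromBool (p 0) + count (p ∘ suc) n + fromBool (p (suc n)) ≡⟨ +-assoc (fromBool (p 0)) _ _ ⟩
  fromBool (p 0) + count (p ∘ suc) (suc n)                ∎
  where open ≡-Reasoning

count-prefix : ∀ {n t} (p : ℕ → Bool) → t < n → count (λ j → does (j ≤? t) ∧ p j) n ≡ count p (suc t)
count-prefix {suc n} {t} p t<1+n with t <? n
... | yes t<n = trans (cong (count _ n +_) (cong (λ b → fromBool (b ∧ p n)) (dec-false (n ≤? t) (<⇒≱ t<n))))
                      (trans (+-identityʳ _) (count-prefix p t<n))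
... | no t≮n rewrite ≤-antisym (s≤s⁻¹ t<1+n) (≮⇒≥ t≮n) | dec-true (n ≤? n) ≤-refl =
  cong (_+ fromBool (p n)) (count-cong n (λ j j<n → cong (_∧ p j) (dec-true (j ≤? n) (<⇒≤ j<n))))

count-∧-2≤ : ∀ (p : ℕ → Bool) → p 0 ≡ true → p 1 ≡ true →
  ∀ n → count (λ i → p i ∧ does (2 ≤? i)) n + 2 ⊓ n ≡ count p n
count-∧-2≤ p p0 p1 zero = refl
count-∧-2≤ p p0 p1 (suc zero) rewrite p0 = refl
count-∧-2≤ p p0 p1 (suc (suc zero)) rewrite p0 | p1 = refl
count-∧-2≤ p p0 p1 (suc (suc (suc n))) = begin
  a + fromBool (p m ∧ true) + 2   ≡⟨ cong (λ b → a + fromBool b + 2) (∧-identityʳ (p m)) ⟩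
  a + fromBool (p m) + 2          ≡⟨ +-assoc a _ 2 ⟩
  a + (fromBool (p m) + 2)        ≡⟨ cong (a +_) (+-comm (fromBool (p m)) 2) ⟩
  a + (2 + fromBool (p m))        ≡⟨ +-assoc a 2 _ ⟨
  a + 2 + fromBool (p m)          ≡⟨ cong (_+ fromBool (p m)) (count-∧-2≤ p p0 p1 (suc (suc n))) ⟩
  count p m + fromBool (p m)      ∎
  where
  open ≡-Reasoning
  m = suc (suc n)
  a = count (λ i → p i ∧ does (2 ≤? i)) m

countFin : ∀ {n} → (Fin n → Bool) → ℕ
countFin g = sum (fromBool ∘ g)

countFin-cong : ∀ {n} {g h : Fin n → Bool} → (∀ i → g i ≡ h i) → countFin g ≡ countFin h
countFin-cong eq = sum-cong-≗ (cong fromBool ∘ eq)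

countFin-toℕ : ∀ n p → countFin {n} (p ∘ toℕ) ≡ count p n
countFin-toℕ zero    p = refl
countFin-toℕ (suc n) p = trans (cong (fromBool (p 0) +_) (countFin-toℕ n (p ∘ suc))) (sym (count-suc-front p n))

countFin-permute : ∀ {n} (g : Fin n → Bool) (π : Permutation′ n) → countFin g ≡ countFin (g ∘ (π ⟨$⟩ʳ_))
countFin-permute g π = sum-permute (fromBool ∘ g) π

length-filter-tabulate : ∀ {a p} {A : Set a} {P : Pred A p} (P? : Decidable P) {n} (h : Fin n → A) →
  length (filter P? (tabulate h)) ≡ countFin (does ∘ P? ∘ h)
length-filter-tabulate P? {zero}  h = refl
length-filter-tabulate P? {suc n} h with does (P? (h fzero))
... | true  = cong suc (length-filter-tabulate P? (h ∘ fsuc))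
... | false = length-filter-tabulate P? (h ∘ fsuc)

length-filter-allFin : ∀ {p} {n} {P : Pred (Fin n) p} (P? : Decidable P) →
  length (filter P? (allFin n)) ≡ countFin (does ∘ P?)
length-filter-allFin P? = length-filter-tabulate P? id

sAct-self : ∀ a → sAct a a ≡ suc a
sAct-self a with a ≟ a
... | yes _   = refl
... | no a≢a = ⊥-elim (a≢a refl)

sAct-suc : ∀ a → sAct a (suc a) ≡ a
sAct-suc a with suc a ≟ a
... | yes 1+a≡a = ⊥-elim (1+n≢n 1+a≡a)
... | no _ with suc a ≟ suc a
...   | yes _     = refl
...   | no 1+a≢1+a = ⊥-elim (1+a≢1+a refl)

sAct-other : ∀ {a x} → x ≢ a → x ≢ suc a → sAct a x ≡ x
sAct-other {a} {x} x≢a x≢1+a with x ≟ a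
... | yes x≡a = ⊥-elim (x≢a x≡a)
... | no _ with x ≟ suc a
...   | yes x≡1+a = ⊥-elim (x≢1+a x≡1+a)
...   | no _      = refl

sAct-involutive : ∀ a x → sAct a (sAct a x) ≡ x
sAct-involutive a x = cases (x ≟ a) (x ≟ suc a)
  where
  cases : Dec (x ≡ a) → Dec (x ≡ suc a) → sAct a (sAct a x) ≡ x
  cases (yes refl) _          = trans (cong (sAct a) (sAct-self a)) (sAct-suc a)
  cases (no _)     (yes refl) = trans (cong (sAct a) (sAct-suc a)) (sAct-self a)
  cases (no x≢a)   (no x≢1+a) = trans (cong (sAct a) (sAct-other x≢a x≢1+a)) (sAct-other x≢a x≢1+a)

evalWordInv : List ℕ → ℕ → ℕ
evalWordInv []       x = x
evalWordInv (a ∷ as) x = evalWordInv as (sAct a x)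

evalWordInv-evalWord : ∀ ws x → evalWordInv ws (evalWord ws x) ≡ x
evalWordInv-evalWord []       x = refl
evalWordInv-evalWord (a ∷ as) x rewrite sAct-involutive a (evalWord as x) = evalWordInv-evalWord as x

evalWord-evalWordInv : ∀ ws x → evalWord ws (evalWordInv ws x) ≡ x
evalWord-evalWordInv []       x = refl
evalWord-evalWordInv (a ∷ as) x rewrite evalWord-evalWordInv as (sAct a x) = sAct-involutive a x

evalWord-++ : ∀ us vs x → evalWord (us ++ vs) x ≡ evalWord us (evalWord vs x)
evalWord-++ []       vs x = refl
evalWord-++ (a ∷ us) vs x = cong (sAct a) (evalWord-++ us vs x)

evalWordInv-++ : ∀ us vs x → evalWordInv (us ++ vs) x ≡ evalWordInv vs (evalWordInv us x)
evalWordInv-++ []       vs x = refl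
evalWordInv-++ (a ∷ us) vs x = evalWordInv-++ us vs (sAct a x)

evalWordInv-representing : ∀ {n} ws (π : Permutation′ n) →
  (∀ x → evalWord ws (suc (toℕ x)) ≡ suc (toℕ (π ⟨$⟩ʳ x))) →
  ∀ y → evalWordInv ws (suc (toℕ y)) ≡ suc (toℕ (π ⟨$⟩ˡ y))
evalWordInv-representing ws π rep y = begin
  evalWordInv ws (suc (toℕ y))                              ≡⟨ cong (evalWordInv ws ∘ suc ∘ toℕ) (inverseʳ π) ⟨
  evalWordInv ws (suc (toℕ (π ⟨$⟩ʳ (π ⟨$⟩ˡ y))))           ≡⟨ cong (evalWordInv ws) (rep (π ⟨$⟩ˡ y)) ⟨
  evalWordInv ws (evalWord ws (suc (toℕ (π ⟨$⟩ˡ y))))      ≡⟨ evalWordInv-evalWord ws _ ⟩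
  suc (toℕ (π ⟨$⟩ˡ y))                                      ∎
  where open ≡-Reasoning

-- The ℕ-analogue of Data.Fin.punchIn: the increasing bijection from ℕ onto ℕ ∖ {p}.
skip : ℕ → ℕ → ℕ
skip zero    x       = suc x
skip (suc p) zero    = zero
skip (suc p) (suc x) = suc (skip p x)

skip-< : ∀ {p x} → x < p → skip p x ≡ x
skip-< {suc p} {zero}  _   = refl
skip-< {suc p} {suc x} x<p = cong suc (skip-< (s<s⁻¹ x<p))

skip-≥ : ∀ {p x} → p ≤ x → skip p x ≡ suc x
skip-≥ {zero}  {x}     _   = refl
skip-≥ {suc p} {suc x} p≤x = cong suc (skip-≥ (s≤s⁻¹ p≤x))

skip-≤-suc : ∀ p x → skip p x ≤ suc x
skip-≤-suc p x with x <? p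
... | yes x<p rewrite skip-< x<p = n≤1+n x
... | no  x≮p rewrite skip-≥ (≮⇒≥ x≮p) = ≤-refl

toℕ-punchIn : ∀ {n} (i : Fin (suc n)) (j : Fin n) → toℕ (punchIn i j) ≡ skip (toℕ i) (toℕ j)
toℕ-punchIn fzero    j        = refl
toℕ-punchIn (fsuc i) fzero    = refl
toℕ-punchIn (fsuc i) (fsuc j) = cong suc (toℕ-punchIn i j)

s<s-does : ∀ x y → does (suc x <? suc y) ≡ does (x <? y)
s<s-does x y = does-⇔ (mk⇔ s<s⁻¹ s<s) (suc x <? suc y) (x <? y)

skip-<?-skip : ∀ p x y → does (skip p x <? skip p y) ≡ does (x <? y)
skip-<?-skip p x y with x <? p | y <? p
... | yes x<p | yes y<p rewrite skip-< x<p | skip-< y<p = refl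
... | yes x<p | no  y≮p rewrite skip-< x<p | skip-≥ (≮⇒≥ y≮p) =
  trans (dec-true (x <? suc y) (m<n⇒m<1+n x<y)) (sym (dec-true (x <? y) x<y))
  where x<y = <-≤-trans x<p (≮⇒≥ y≮p)
... | no  x≮p | yes y<p rewrite skip-≥ (≮⇒≥ x≮p) | skip-< y<p =
  trans (dec-false (suc x <? y) (<⇒≯ (<-trans y<x (n<1+n x)))) (sym (dec-false (x <? y) (<⇒≯ y<x)))
  where y<x = <-≤-trans y<p (≮⇒≥ x≮p)
... | no  x≮p | no  y≮p rewrite skip-≥ (≮⇒≥ x≮p) | skip-≥ (≮⇒≥ y≮p) = s<s-does x y

skip-<?-below : ∀ p {c} x → c ≤ p → does (skip p x <? c) ≡ does (x <? c)
skip-<?-below p {c} x c≤p with x <? p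
... | yes x<p rewrite skip-< x<p = refl
... | no  x≮p rewrite skip-≥ (≮⇒≥ x≮p) =
  trans (dec-false (suc x <? c) (≤⇒≯ (m≤n⇒m≤1+n c≤x))) (sym (dec-false (x <? c) (≤⇒≯ c≤x)))
  where c≤x = ≤-trans c≤p (≮⇒≥ x≮p)

skip-<?-above : ∀ p {v} x → p ≤ v → does (skip p x <? suc v) ≡ does (x <? v)
skip-<?-above p {v} x p≤v with x <? p
... | yes x<p rewrite skip-< x<p =
  trans (dec-true (x <? suc v) (m<n⇒m<1+n x<v)) (sym (dec-true (x <? v) x<v))
  where x<v = <-≤-trans x<p p≤v
... | no  x≮p rewrite skip-≥ (≮⇒≥ x≮p) = s<s-does x v

evalWordInv-seg-> : ∀ j k {x} → suc j < x → evalWordInv (seg j k) x ≡ x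
evalWordInv-seg-> j zero    _     = refl
evalWordInv-seg-> j (suc k) 1+j<x rewrite sAct-other (>⇒≢ (<-trans (n<1+n j) 1+j<x)) (>⇒≢ 1+j<x) =
  evalWordInv-seg-> (j ∸ 1) k (<-≤-trans (s≤s (s≤s (m∸n≤m j 1))) 1+j<x)

evalWordInv-seg-top : ∀ {j k} → k ≤ j → evalWordInv (seg j k) (suc j) ≡ suc (j ∸ k)
evalWordInv-seg-top {j}     {zero}  _         = refl
evalWordInv-seg-top {suc j} {suc k} (s≤s k≤j) rewrite sAct-suc (suc j) = evalWordInv-seg-top k≤j

evalWordInv-seg-≤ : ∀ {j k x} → k ≤ j → x ≤ j → evalWordInv (seg j k) x ≡ skip (suc (j ∸ k)) x
evalWordInv-seg-≤ {j} {zero} _ x≤j = sym (skip-< (s≤s x≤j))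
evalWordInv-seg-≤ {suc j} {suc k} {x} (s≤s k≤j) x≤1+j = cases (x ≟ suc j)
  where
  cases : Dec (x ≡ suc j) → evalWordInv (seg j k) (sAct (suc j) x) ≡ skip (suc (j ∸ k)) x
  cases (yes refl) rewrite sAct-self (suc j) =
    trans (evalWordInv-seg-> j k ≤-refl) (sym (skip-≥ (s≤s (m∸n≤m j k))))
  cases (no x≢1+j) rewrite sAct-other x≢1+j (λ x≡2+j → 1+n≰n (subst (_≤ suc j) x≡2+j x≤1+j)) =
    evalWordInv-seg-≤ k≤j (s≤s⁻¹ (≤∧≢⇒< x≤1+j x≢1+j))

evalWord-seg-top : ∀ {j k} → k ≤ j → evalWord (seg j k) (suc (j ∸ k)) ≡ suc j
evalWord-seg-top {j} {k} k≤j =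
  trans (cong (evalWord (seg j k)) (sym (evalWordInv-seg-top k≤j))) (evalWord-evalWordInv (seg j k) (suc j))

evalWord-seg-skip : ∀ {j k x} → k ≤ j → x ≤ j → evalWord (seg j k) (skip (suc (j ∸ k)) x) ≡ x
evalWord-seg-skip {j} {k} {x} k≤j x≤j =
  trans (cong (evalWord (seg j k)) (sym (evalWordInv-seg-≤ k≤j x≤j))) (evalWord-evalWordInv (seg j k) x)

occurrences-++ : ∀ a us vs → occurrences a (us ++ vs) ≡ occurrences a us + occurrences a vs
occurrences-++ a us vs = trans (cong length (filter-++ (_≟ a) us vs)) (length-++ (filter (_≟ a) us))

occurrences-2-seg : ∀ {j k} → k ≤ j → occurrences 2 (seg j k) ≡ fromBool (does (j ∸ k ≤? 1) ∧ does (2 ≤? j))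
occurrences-2-seg {zero}              {zero}                _         = refl
occurrences-2-seg {suc zero}          {zero}                _         = refl
occurrences-2-seg {suc (suc j)}       {zero}                _         = refl
occurrences-2-seg {suc zero}          {suc zero}            _         = refl
occurrences-2-seg {suc (suc zero)}    {suc zero}            _         = refl
occurrences-2-seg {suc (suc zero)}    {suc (suc zero)}      _         = refl
occurrences-2-seg {suc zero}          {suc (suc _)}         (s≤s ())
occurrences-2-seg {suc (suc zero)}    {suc (suc (suc _))}   (s≤s (s≤s ()))
occurrences-2-seg {suc (suc (suc j))} {suc k}               (s≤s k≤j) = occurrences-2-seg k≤j

smallerBeforeℕ : (ℕ → ℕ) → ℕ → ℕ
smallerBeforeℕ u i = count (λ j → does (u j <? u i)) (suc i)

smallerBeforeℕ-≤ : ∀ u i → smallerBeforeℕ u i ≤ i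
smallerBeforeℕ-≤ u i rewrite dec-false (u i <? u i) (<-irrefl refl) =
  ≤-trans (≤-reflexive (+-identityʳ _)) (count-≤ _ i)

almLRminAℕ : (ℕ → ℕ) → ℕ → ℕ
almLRminAℕ u n = count (λ i → does (smallerBeforeℕ u i ≤? 1) ∧ does (2 ≤? i)) n

almLRminℕ : (ℕ → ℕ) → ℕ → ℕ
almLRminℕ u n = count (λ i → does (smallerBeforeℕ u i ≤? 1)) n

almLRminAℕ-+-2⊓ : ∀ u n → almLRminAℕ u n + 2 ⊓ n ≡ almLRminℕ u n
almLRminAℕ-+-2⊓ u = count-∧-2≤ _
  (dec-true (_ ≤? 1) (≤-trans (smallerBeforeℕ-≤ u 0) z≤n))
  (dec-true (_ ≤? 1) (smallerBeforeℕ-≤ u 1))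

-- The product w_1 ⋯ w_m, where w_{j+1} ∈ R^S_{j+1} has k j factors.
module PrefixProduct (k : ℕ → ℕ) where

  word : ℕ → List ℕ
  word zero    = []
  word (suc m) = word m ++ seg (suc m) (k m)

  Bounded : ℕ → Set
  Bounded m = ∀ j → j < m → k j ≤ suc j

  Bounded-pred : ∀ {m} → Bounded (suc m) → Bounded m
  Bounded-pred b j j<m = b j (m<n⇒m<1+n j<m)

  -- One-line notation of (w_1 ⋯ w_m)⁻¹ ∈ S_{m+1}, with 0-based positions and 1-based values.
  inv : ℕ → ℕ → ℕ
  inv m i = evalWordInv (word m) (suc i)

  evalWordInv-word-suc : ∀ m x →
    evalWordInv (word (suc m)) x ≡ evalWordInv (seg (suc m) (k m)) (evalWordInv (word m) x)
  evalWordInv-word-suc m = evalWordInv-++ (word m) (seg (suc m) (k m))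

  evalWordInv-word-> : ∀ m {x} → suc m < x → evalWordInv (word m) x ≡ x
  evalWordInv-word-> zero    _       = refl
  evalWordInv-word-> (suc m) {x} 1+m<x
    rewrite evalWordInv-word-suc m x | evalWordInv-word-> m (<-trans (n<1+n (suc m)) 1+m<x) =
    evalWordInv-seg-> (suc m) (k m) 1+m<x

  evalWord-word-> : ∀ m {x} → suc m < x → evalWord (word m) x ≡ x
  evalWord-word-> m {x} 1+m<x =
    trans (cong (evalWord (word m)) (sym (evalWordInv-word-> m 1+m<x))) (evalWord-evalWordInv (word m) x)

  inv-last : ∀ {m} → Bounded (suc m) → inv (suc m) (suc m) ≡ suc (suc m ∸ k m)
  inv-last {m} b rewrite evalWordInv-word-suc m (suc (suc m)) | evalWordInv-word-> m (n<1+n (suc m)) =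
    evalWordInv-seg-top (b m ≤-refl)

  inv-≤ : ∀ {m} → Bounded m → ∀ {i} → i ≤ m → inv m i ≤ suc m
  inv-skip : ∀ {m} → Bounded (suc m) → ∀ {i} → i ≤ m → inv (suc m) i ≡ skip (suc (suc m ∸ k m)) (inv m i)

  inv-≤ {zero}  _ z≤n = ≤-refl
  inv-≤ {suc m} b {i} i≤1+m with m≤n⇒m<n∨m≡n i≤1+m
  ... | inj₁ (s≤s i≤m) rewrite inv-skip b i≤m = ≤-trans (skip-≤-suc _ (inv m i)) (s≤s (inv-≤ (Bounded-pred b) i≤m))
  ... | inj₂ refl      rewrite inv-last b     = s≤s (m∸n≤m (suc m) (k m))

  inv-skip {m} b {i} i≤m =
    trans (evalWordInv-word-suc m (suc i)) (evalWordInv-seg-≤ (b m ≤-refl) (inv-≤ (Bounded-pred b) i≤m))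

  -- inv m permutes {1, …, m+1}, so exactly v of its values lie below v + 1.
  count-inv-< : ∀ {m} → Bounded m → ∀ {v} → v ≤ suc m → count (λ j → does (inv m j <? suc v)) (suc m) ≡ v
  count-inv-< {zero}  _ {zero}        _          = refl
  count-inv-< {zero}  _ {suc zero}    _          = refl
  count-inv-< {zero}  _ {suc (suc _)} (s≤s ())
  count-inv-< {suc m} b {v} v≤2+m rewrite inv-last b with v <? suc (suc m ∸ k m)
  ... | yes v<p rewrite dec-false (suc (suc m ∸ k m) <? suc v) (λ p<1+v → <⇒≱ v<p (s≤s⁻¹ p<1+v)) = begin
    count (λ j → does (inv (suc m) j <? suc v)) (suc m) + 0  ≡⟨ +-identityʳ _ ⟩
    count (λ j → does (inv (suc m) j <? suc v)) (suc m)      ≡⟨ count-cong (suc m) below ⟩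
    count (λ j → does (inv m j <? suc v)) (suc m)            ≡⟨ count-inv-< (Bounded-pred b) v≤1+m ⟩
    v                                                        ∎
    where
    open ≡-Reasoning
    v≤1+m = ≤-trans (s≤s⁻¹ v<p) (m∸n≤m (suc m) (k m))
    below : ∀ j → j < suc m → does (inv (suc m) j <? suc v) ≡ does (inv m j <? suc v)
    below j j<1+m rewrite inv-skip b (s≤s⁻¹ j<1+m) = skip-<?-below (suc (suc m ∸ k m)) (inv m j) v<p
  ... | no v≮p = above (≮⇒≥ v≮p) v≤2+m
    where
    open ≡-Reasoning
    p = suc (suc m ∸ k m)
    above : ∀ {v} → p ≤ v → v ≤ suc (suc m) →
      count (λ j → does (inv (suc m) j <? suc v)) (suc m) + fromBool (does (p <? suc v)) ≡ v
    above {suc v} p≤1+v 1+v≤2+m rewrite dec-true (p <? suc (suc v)) (s≤s p≤1+v) = begin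
      count (λ j → does (inv (suc m) j <? suc (suc v))) (suc m) + 1  ≡⟨ +-comm _ 1 ⟩
      suc (count (λ j → does (inv (suc m) j <? suc (suc v))) (suc m)) ≡⟨ cong suc (count-cong (suc m) shifted) ⟩
      suc (count (λ j → does (inv m j <? suc v)) (suc m))            ≡⟨ cong suc (count-inv-< (Bounded-pred b) (s≤s⁻¹ 1+v≤2+m)) ⟩
      suc v                                                          ∎
      where
      shifted : ∀ j → j < suc m → does (inv (suc m) j <? suc (suc v)) ≡ does (inv m j <? suc v)
      shifted j j<1+m rewrite inv-skip b (s≤s⁻¹ j<1+m) = skip-<?-above p (inv m j) p≤1+v

  smallerBeforeℕ-inv : ∀ {m} → Bounded (suc m) → ∀ {i} → i ≤ m →
    smallerBeforeℕ (inv (suc m)) i ≡ smallerBeforeℕ (inv m) i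
  smallerBeforeℕ-inv {m} b {i} i≤m = count-cong (suc i) λ j j<1+i →
    trans (cong₂ (λ y z → does (y <? z)) (inv-skip b (≤-trans (s≤s⁻¹ j<1+i) i≤m)) (inv-skip b i≤m))
          (skip-<?-skip (suc (suc m ∸ k m)) (inv m j) (inv m i))

  smallerBeforeℕ-inv-last : ∀ {m} → Bounded (suc m) → smallerBeforeℕ (inv (suc m)) (suc m) ≡ suc m ∸ k m
  smallerBeforeℕ-inv-last {m} b
    rewrite inv-last b | dec-false (suc (suc m ∸ k m) <? suc (suc m ∸ k m)) (<-irrefl refl) = begin
    count (λ j → does (inv (suc m) j <? p)) (suc m) + 0  ≡⟨ +-identityʳ _ ⟩
    count (λ j → does (inv (suc m) j <? p)) (suc m)      ≡⟨ count-cong (suc m) below ⟩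
    count (λ j → does (inv m j <? p)) (suc m)            ≡⟨ count-inv-< (Bounded-pred b) (m∸n≤m (suc m) (k m)) ⟩
    suc m ∸ k m                                          ∎
    where
    open ≡-Reasoning
    p = suc (suc m ∸ k m)
    below : ∀ j → j < suc m → does (inv (suc m) j <? p) ≡ does (inv m j <? p)
    below j j<1+m rewrite inv-skip b (s≤s⁻¹ j<1+m) = skip-<?-below p (inv m j) ≤-refl

  occurrences-2-word : ∀ {m} → Bounded m → occurrences 2 (word m) ≡ almLRminAℕ (inv m) (suc m)
  occurrences-2-word {zero}  _ = refl
  occurrences-2-word {suc m} b = begin
    occurrences 2 (word m ++ seg (suc m) (k m))
      ≡⟨ occurrences-++ 2 (word m) (seg (suc m) (k m)) ⟩
    occurrences 2 (word m) + occurrences 2 (seg (suc m) (k m))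
      ≡⟨ cong₂ _+_ (occurrences-2-word (Bounded-pred b)) (occurrences-2-seg (b m ≤-refl)) ⟩
    almLRminAℕ (inv m) (suc m) + fromBool (does (suc m ∸ k m ≤? 1) ∧ does (2 ≤? suc m))
      ≡⟨ cong₂ _+_ (count-cong (suc m) earlier) (cong (λ s → fromBool (does (s ≤? 1) ∧ does (2 ≤? suc m)))
                                                      (sym (smallerBeforeℕ-inv-last b))) ⟩
    almLRminAℕ (inv (suc m)) (suc (suc m))
      ∎
    where
    open ≡-Reasoning
    earlier : ∀ i → i < suc m → does (smallerBeforeℕ (inv m) i ≤? 1) ∧ does (2 ≤? i)
                              ≡ does (smallerBeforeℕ (inv (suc m)) i ≤? 1) ∧ does (2 ≤? i)
    earlier i i<1+m rewrite smallerBeforeℕ-inv b (s≤s⁻¹ i<1+m) = refl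

almLRmin : ∀ {n} → (Fin n → Fin n) → ℕ
almLRmin {n} u = length (filter (λ i → smallerBefore u i ≤? 1) (allFin n))

smallerBefore-countFin : ∀ {n} (u : Fin n → Fin n) i →
  smallerBefore u i ≡ countFin (λ j → does (toℕ j ≤? toℕ i) ∧ does (toℕ (u j) <? toℕ (u i)))
smallerBefore-countFin u i = length-filter-allFin (λ j → (toℕ j ≤? toℕ i) ×-dec (toℕ (u j) <? toℕ (u i)))

almLRmin-countFin : ∀ {n} (u : Fin n → Fin n) → almLRmin u ≡ countFin (λ i → does (smallerBefore u i ≤? 1))
almLRmin-countFin u = length-filter-allFin (λ i → smallerBefore u i ≤? 1)

almLRminA-countFin : ∀ {n} (u : Fin n → Fin n) →
  almLRminA u ≡ countFin (λ i → does (smallerBefore u i ≤? 1) ∧ does (2 ≤? toℕ i))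
almLRminA-countFin u = length-filter-allFin (λ i → (smallerBefore u i ≤? 1) ×-dec (2 ≤? toℕ i))

almLRminB-countFin : ∀ {n} (u : Fin n → Fin n) →
  almLRminB u ≡ countFin (λ i → does (smallerBefore u i ≤? 1) ∧ does (2 ≤? toℕ (u i)))
almLRminB-countFin u = length-filter-allFin (λ i → (smallerBefore u i ≤? 1) ×-dec (2 ≤? toℕ (u i)))

smallerBefore-toℕ : ∀ {n} (u : Fin n → Fin n) (U : ℕ → ℕ) → (∀ x → U (toℕ x) ≡ suc (toℕ (u x))) →
  ∀ i → smallerBefore u i ≡ smallerBeforeℕ U (toℕ i)
smallerBefore-toℕ {n} u U U≗ i = begin
  smallerBefore u i
    ≡⟨ smallerBefore-countFin u i ⟩
  countFin {n} (λ j → does (toℕ j ≤? toℕ i) ∧ does (toℕ (u j) <? toℕ (u i)))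
    ≡⟨ countFin-cong (λ j → cong (does (toℕ j ≤? toℕ i) ∧_) (values j)) ⟩
  countFin {n} ((λ j → does (j ≤? toℕ i) ∧ does (U j <? U (toℕ i))) ∘ toℕ)
    ≡⟨ countFin-toℕ n (λ j → does (j ≤? toℕ i) ∧ does (U j <? U (toℕ i))) ⟩
  count (λ j → does (j ≤? toℕ i) ∧ does (U j <? U (toℕ i))) n
    ≡⟨ count-prefix (λ j → does (U j <? U (toℕ i))) (toℕ<n i) ⟩
  smallerBeforeℕ U (toℕ i)
    ∎
  where
  open ≡-Reasoning
  values : ∀ j → does (toℕ (u j) <? toℕ (u i)) ≡ does (U (toℕ j) <? U (toℕ i))
  values j rewrite U≗ j | U≗ i = sym (s<s-does (toℕ (u j)) (toℕ (u i)))

almLRminA-toℕ : ∀ {n} (u : Fin n → Fin n) (U : ℕ → ℕ) → (∀ x → U (toℕ x) ≡ suc (toℕ (u x))) →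
  almLRminA u ≡ almLRminAℕ U n
almLRminA-toℕ {n} u U U≗ = trans (almLRminA-countFin u) (trans
  (countFin-cong (λ i → cong (λ s → does (s ≤? 1) ∧ does (2 ≤? toℕ i)) (smallerBefore-toℕ u U U≗ i)))
  (countFin-toℕ n (λ i → does (smallerBeforeℕ U i ≤? 1) ∧ does (2 ≤? i))))

almLRmin-toℕ : ∀ {n} (u : Fin n → Fin n) (U : ℕ → ℕ) → (∀ x → U (toℕ x) ≡ suc (toℕ (u x))) →
  almLRmin u ≡ almLRminℕ U n
almLRmin-toℕ {n} u U U≗ = trans (almLRmin-countFin u) (trans
  (countFin-cong (λ i → cong (λ s → does (s ≤? 1)) (smallerBefore-toℕ u U U≗ i)))
  (countFin-toℕ n (λ i → does (smallerBeforeℕ U i ≤? 1))))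

extendℕ : ∀ {n} → (Fin n → Fin n) → ℕ → ℕ
extendℕ {n} u i with i <? n
... | yes i<n = suc (toℕ (u (fromℕ< i<n)))
... | no  _   = 0

extendℕ-toℕ : ∀ {n} (u : Fin n → Fin n) x → extendℕ u (toℕ x) ≡ suc (toℕ (u x))
extendℕ-toℕ {n} u x with toℕ x <? n
... | yes x<n = cong (suc ∘ toℕ ∘ u) (fromℕ<-toℕ x x<n)
... | no  x≮n = ⊥-elim (x≮n (toℕ<n x))

almLRminA-+-2⊓ : ∀ {n} (u : Fin n → Fin n) → almLRminA u + 2 ⊓ n ≡ almLRmin u
almLRminA-+-2⊓ {n} u rewrite almLRminA-toℕ u (extendℕ u) (extendℕ-toℕ u) | almLRmin-toℕ u (extendℕ u) (extendℕ-toℕ u) =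
  almLRminAℕ-+-2⊓ (extendℕ u) n

≤×<-swap : ∀ {a b c d : ℕ} → (a ≡ b → c ≡ d) → a ≤ b × c < d → c ≤ d × a < b
≤×<-swap a≡b⇒c≡d (a≤b , c<d) = <⇒≤ c<d , ≤∧≢⇒< a≤b (<⇒≢ c<d ∘ a≡b⇒c≡d)

smallerBefore-inverse : ∀ {n} (π : Permutation′ n) v →
  smallerBefore (π ⟨$⟩ʳ_) (π ⟨$⟩ˡ v) ≡ smallerBefore (π ⟨$⟩ˡ_) v
smallerBefore-inverse {n} π v = begin
  smallerBefore (π ⟨$⟩ʳ_) i
    ≡⟨ smallerBefore-countFin (π ⟨$⟩ʳ_) i ⟩
  countFin {n} (λ j → does (toℕ j ≤? toℕ i) ∧ does (toℕ (π ⟨$⟩ʳ j) <? toℕ (π ⟨$⟩ʳ i)))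
    ≡⟨ countFin-cong swapped ⟩
  countFin {n} (g ∘ (π ⟨$⟩ʳ_))
    ≡⟨ countFin-permute g π ⟨
  countFin g
    ≡⟨ smallerBefore-countFin (π ⟨$⟩ˡ_) v ⟨
  smallerBefore (π ⟨$⟩ˡ_) v
    ∎
  where
  open ≡-Reasoning
  i = π ⟨$⟩ˡ v
  g : Fin n → Bool
  g j = does (toℕ j ≤? toℕ v) ∧ does (toℕ (π ⟨$⟩ˡ j) <? toℕ i)
  swapped : ∀ j → does (toℕ j ≤? toℕ i) ∧ does (toℕ (π ⟨$⟩ʳ j) <? toℕ (π ⟨$⟩ʳ i)) ≡ g (π ⟨$⟩ʳ j)
  swapped j rewrite inverseˡ π {j} | inverseʳ π {v} =
    does-⇔ (mk⇔ (≤×<-swap j≡i⇒πj≡v) (≤×<-swap πj≡v⇒j≡i))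
      ((toℕ j ≤? toℕ i) ×-dec (toℕ (π ⟨$⟩ʳ j) <? toℕ v)) ((toℕ (π ⟨$⟩ʳ j) ≤? toℕ v) ×-dec (toℕ j <? toℕ i))
    where
    j≡i⇒πj≡v : toℕ j ≡ toℕ i → toℕ (π ⟨$⟩ʳ j) ≡ toℕ v
    j≡i⇒πj≡v eq = cong toℕ (trans (cong (π ⟨$⟩ʳ_) (toℕ-injective eq)) (inverseʳ π))
    πj≡v⇒j≡i : toℕ (π ⟨$⟩ʳ j) ≡ toℕ v → toℕ j ≡ toℕ i
    πj≡v⇒j≡i eq = cong toℕ (trans (sym (inverseˡ π)) (cong (π ⟨$⟩ˡ_) (toℕ-injective eq)))

countFin-smallerBefore-inverse : ∀ {n} (π : Permutation′ n) (P : ℕ → Fin n → Bool) →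
  countFin {n} (λ i → P (smallerBefore (π ⟨$⟩ʳ_) i) (π ⟨$⟩ʳ i)) ≡ countFin (λ v → P (smallerBefore (π ⟨$⟩ˡ_) v) v)
countFin-smallerBefore-inverse π P =
  trans (countFin-permute _ (flip π)) (countFin-cong λ v → cong₂ P (smallerBefore-inverse π v) (inverseʳ π))

almLRminB-inverse : ∀ {n} (π : Permutation′ n) → almLRminB (π ⟨$⟩ʳ_) ≡ almLRminA (π ⟨$⟩ˡ_)
almLRminB-inverse π = trans (almLRminB-countFin (π ⟨$⟩ʳ_)) (trans
  (countFin-smallerBefore-inverse π (λ s v → does (s ≤? 1) ∧ does (2 ≤? toℕ v)))
  (sym (almLRminA-countFin (π ⟨$⟩ˡ_))))

almLRmin-inverse : ∀ {n} (π : Permutation′ n) → almLRmin (π ⟨$⟩ʳ_) ≡ almLRmin (π ⟨$⟩ˡ_)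
almLRmin-inverse π = trans (almLRmin-countFin (π ⟨$⟩ʳ_)) (trans
  (countFin-smallerBefore-inverse π (λ s _ → does (s ≤? 1)))
  (sym (almLRmin-countFin (π ⟨$⟩ˡ_))))

almLRminA-inverse : ∀ {n} (π : Permutation′ n) → almLRminA (π ⟨$⟩ʳ_) ≡ almLRminA (π ⟨$⟩ˡ_)
almLRminA-inverse {n} π = +-cancelʳ-≡ (2 ⊓ n) _ _
  (trans (almLRminA-+-2⊓ (π ⟨$⟩ʳ_)) (trans (almLRmin-inverse π) (sym (almLRminA-+-2⊓ (π ⟨$⟩ˡ_)))))

word-cong : ∀ {k k′} m → (∀ j → j < m → k j ≡ k′ j) → PrefixProduct.word k m ≡ PrefixProduct.word k′ m
word-cong zero    eq = refl
word-cong (suc m) eq = cong₂ _++_ (word-cong m (λ j j<m → eq j (m<n⇒m<1+n j<m))) (cong (seg (suc m)) (eq m ≤-refl))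

extendAt : (ℕ → ℕ) → ℕ → ℕ → ℕ → ℕ
extendAt k m c j with j <? m
... | yes _ = k j
... | no  _ = c

extendAt-< : ∀ k m c {j} → j < m → extendAt k m c j ≡ k j
extendAt-< k m c {j} j<m with j <? m
... | yes _   = refl
... | no  j≮m = ⊥-elim (j≮m j<m)

extendAt-≥ : ∀ k m c {j} → m ≤ j → extendAt k m c j ≡ c
extendAt-≥ k m c {j} m≤j with j <? m
... | yes j<m = ⊥-elim (<⇒≱ j<m m≤j)
... | no  _   = refl

toℕ-punchIn-last : ∀ {n} (y : Fin n) → toℕ (punchIn (fromℕ n) y) ≡ toℕ y
toℕ-punchIn-last {n} y =
  trans (toℕ-punchIn (fromℕ n) y) (skip-< (subst (toℕ y <_) (sym (toℕ-fromℕ n)) (toℕ<n y)))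

-- Induction on n: the factor w_{n-1} is the cycle carrying the position of the value n to the end.
factorCounts-exist : ∀ m (w : Permutation′ (suc m)) → ∃[ k ] PrefixProduct.Bounded k m ×
  (∀ x → evalWord (PrefixProduct.word k m) (suc (toℕ x)) ≡ suc (toℕ (w ⟨$⟩ʳ x)))
factorCounts-exist zero w = (λ _ → 0) , (λ _ ()) , represents
  where
  represents : ∀ x → suc (toℕ x) ≡ suc (toℕ (w ⟨$⟩ʳ x))
  represents fzero with w ⟨$⟩ʳ fzero
  ... | fzero = refl
factorCounts-exist (suc m) w = k , bounded , represents
  where
  open PrefixProduct
  p = w ⟨$⟩ˡ fromℕ (suc m)
  c = suc m ∸ toℕ p
  c≤1+m : c ≤ suc m
  c≤1+m = m∸n≤m (suc m) (toℕ p)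
  top≡p : suc (suc m ∸ c) ≡ suc (toℕ p)
  top≡p = cong suc (m∸[m∸n]≡n (s≤s⁻¹ (toℕ<n p)))
  w′ = remove p w
  IH = factorCounts-exist m w′
  k′ = proj₁ IH
  k = extendAt k′ m c

  bounded : Bounded k (suc m)
  bounded j j<1+m with m≤n⇒m<n∨m≡n (s≤s⁻¹ j<1+m)
  ... | inj₁ j<m  rewrite extendAt-< k′ m c j<m = proj₁ (proj₂ IH) j j<m
  ... | inj₂ refl rewrite extendAt-≥ k′ m c ≤-refl = c≤1+m

  word≡ : word k (suc m) ≡ word k′ m ++ seg (suc m) c
  word≡ = cong₂ _++_ (word-cong m (λ j → extendAt-< k′ m c)) (cong (seg (suc m)) (extendAt-≥ k′ m c ≤-refl))

  at-p : evalWord (word k′ m ++ seg (suc m) c) (suc (toℕ p)) ≡ suc (toℕ (w ⟨$⟩ʳ p))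
  at-p = begin
    evalWord (word k′ m ++ seg (suc m) c) (suc (toℕ p))         ≡⟨ evalWord-++ (word k′ m) (seg (suc m) c) _ ⟩
    evalWord (word k′ m) (evalWord (seg (suc m) c) (suc (toℕ p))) ≡⟨ cong (evalWord (word k′ m) ∘ evalWord (seg (suc m) c)) top≡p ⟨
    evalWord (word k′ m) (evalWord (seg (suc m) c) (suc (suc m ∸ c))) ≡⟨ cong (evalWord (word k′ m)) (evalWord-seg-top c≤1+m) ⟩
    evalWord (word k′ m) (suc (suc m))                          ≡⟨ evalWord-word-> k′ m (n<1+n (suc m)) ⟩
    suc (suc m)                                                 ≡⟨ cong suc (toℕ-fromℕ (suc m)) ⟨
    suc (toℕ (fromℕ (suc m)))                                   ≡⟨ cong (suc ∘ toℕ) (inverseʳ w) ⟨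
    suc (toℕ (w ⟨$⟩ʳ p))                                        ∎
    where open ≡-Reasoning

  off-p : ∀ z → evalWord (word k′ m ++ seg (suc m) c) (suc (toℕ (punchIn p z))) ≡ suc (toℕ (w ⟨$⟩ʳ punchIn p z))
  off-p z = begin
    evalWord (word k′ m ++ seg (suc m) c) (suc (toℕ (punchIn p z)))            ≡⟨ evalWord-++ (word k′ m) (seg (suc m) c) _ ⟩
    evalWord (word k′ m) (evalWord (seg (suc m) c) (suc (toℕ (punchIn p z))))  ≡⟨ cong (evalWord (word k′ m) ∘ evalWord (seg (suc m) c)) skipped ⟩
    evalWord (word k′ m) (evalWord (seg (suc m) c) (skip (suc (suc m ∸ c)) (suc (toℕ z))))
      ≡⟨ cong (evalWord (word k′ m)) (evalWord-seg-skip c≤1+m (toℕ<n z)) ⟩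
    evalWord (word k′ m) (suc (toℕ z))                                        ≡⟨ proj₂ (proj₂ IH) z ⟩
    suc (toℕ (w′ ⟨$⟩ʳ z))                                                      ≡⟨ cong suc (toℕ-punchIn-last (w′ ⟨$⟩ʳ z)) ⟨
    suc (toℕ (punchIn (fromℕ (suc m)) (w′ ⟨$⟩ʳ z)))                           ≡⟨ cong (suc ∘ toℕ) (punchIn-permute′ w (fromℕ (suc m)) z) ⟨
    suc (toℕ (w ⟨$⟩ʳ punchIn p z))                                             ∎
    where
    open ≡-Reasoning
    skipped : suc (toℕ (punchIn p z)) ≡ skip (suc (suc m ∸ c)) (suc (toℕ z))
    skipped = trans (cong suc (toℕ-punchIn p z)) (cong (λ q → skip q (suc (toℕ z))) (sym top≡p))

  represents : ∀ x → evalWord (word k (suc m)) (suc (toℕ x)) ≡ suc (toℕ (w ⟨$⟩ʳ x))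
  represents x rewrite word≡ with p ≟ᶠ x
  ... | yes refl = at-p
  ... | no  p≢x  = subst (λ y → evalWord (word k′ m ++ seg (suc m) c) (suc (toℕ y)) ≡ suc (toℕ (w ⟨$⟩ʳ y)))
                         (punchIn-punchOut p≢x) (off-p (punchOut p≢x))

-- factorCount f j is the number of factors of w_{j+1}; indices j ≥ m get the junk value 0.
factorCount : ∀ {m} → Factorization (suc m) → ℕ → ℕ
factorCount {m} f j with j <? m
... | yes j<m = toℕ (f (fromℕ< j<m))
... | no  _   = 0

factorCount-toℕ : ∀ {m} (f : Factorization (suc m)) jf → toℕ (f jf) ≡ factorCount f (toℕ jf)
factorCount-toℕ {m} f jf with toℕ jf <? m
... | yes j<m = cong (toℕ ∘ f) (sym (fromℕ<-toℕ jf j<m))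
... | no  j≮m = ⊥-elim (j≮m (toℕ<n jf))

factorCount-bounded : ∀ {m} (f : Factorization (suc m)) → PrefixProduct.Bounded (factorCount f) m
factorCount-bounded {m} f j j<m with j <? m
... | yes j<m′ = subst (λ t → toℕ (f (fromℕ< j<m′)) ≤ suc t) (toℕ-fromℕ< j<m′) (s≤s⁻¹ (toℕ<n (f (fromℕ< j<m′))))
... | no  j≮m  = ⊥-elim (j≮m j<m)

concat-tabulate-snoc : ∀ {A : Set} m (g : Fin (suc m) → List A) →
  concat (tabulate g) ≡ concat (tabulate (g ∘ inject₁)) ++ g (fromℕ m)
concat-tabulate-snoc zero    g = ++-identityʳ (g fzero)
concat-tabulate-snoc (suc m) g =
  trans (cong (g fzero ++_) (concat-tabulate-snoc m (g ∘ fsuc))) (sym (++-assoc (g fzero) _ _))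

concat-tabulate-word : ∀ k m (g : Fin m → List ℕ) → (∀ jf → g jf ≡ seg (suc (toℕ jf)) (k (toℕ jf))) →
  concat (tabulate g) ≡ PrefixProduct.word k m
concat-tabulate-word k zero    g eq = refl
concat-tabulate-word k (suc m) g eq = trans (concat-tabulate-snoc m g) (cong₂ _++_
  (concat-tabulate-word k m (g ∘ inject₁) (λ jf → trans (eq (inject₁ jf)) (cong (λ t → seg (suc t) (k t)) (toℕ-inject₁ jf))))
  (trans (eq (fromℕ m)) (cong (λ t → seg (suc t) (k t)) (toℕ-fromℕ m))))

factWord-word : ∀ {m} (f : Factorization (suc m)) k → (∀ jf → toℕ (f jf) ≡ k (toℕ jf)) →
  factWord (suc m) f ≡ PrefixProduct.word k m
factWord-word {m} f k eq = trans (cong concat (map-tabulate id (λ jf → seg (suc (toℕ jf)) (toℕ (f jf)))))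
  (concat-tabulate-word k m _ (λ jf → cong (seg (suc (toℕ jf))) (eq jf)))

factorization-exists : ∀ n (w : Permutation′ n) → ∃ λ (f : Factorization n) → Represents n f w
factorization-exists zero    w = (λ ()) , (λ ())
factorization-exists (suc m) w = f , λ x → trans (cong (λ ws → evalWord ws (suc (toℕ x))) word≡) (represents x)
  where
  k = proj₁ (factorCounts-exist m w)
  represents = proj₂ (proj₂ (factorCounts-exist m w))
  f : Factorization (suc m)
  f jf = fromℕ< (s≤s (proj₁ (proj₂ (factorCounts-exist m w)) (toℕ jf) (toℕ<n jf)))
  word≡ = factWord-word f k (λ jf → toℕ-fromℕ< _)

occurrences-2-factWord : ∀ n (w : Permutation′ n) (f : Factorization n) → Represents n f w →
  occurrences 2 (factWord n f) ≡ almLRminA (w ⟨$⟩ˡ_)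
occurrences-2-factWord zero    w f _   = refl
occurrences-2-factWord (suc m) w f rep = begin
  occurrences 2 (factWord (suc m) f)  ≡⟨ cong (occurrences 2) word≡ ⟩
  occurrences 2 (word m)              ≡⟨ occurrences-2-word (factorCount-bounded f) ⟩
  almLRminAℕ (inv m) (suc m)          ≡⟨ almLRminA-toℕ (w ⟨$⟩ˡ_) (inv m) inv≗ ⟨
  almLRminA (w ⟨$⟩ˡ_)                 ∎
  where
  open ≡-Reasoning
  open PrefixProduct (factorCount f)
  word≡ : factWord (suc m) f ≡ word m
  word≡ = factWord-word f (factorCount f) (factorCount-toℕ f)
  inv≗ : ∀ y → inv m (toℕ y) ≡ suc (toℕ (w ⟨$⟩ˡ y))
  inv≗ = evalWordInv-representing (word m) w λ x → trans (cong (λ ws → evalWord ws (suc (toℕ x))) (sym word≡)) (rep x)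

proposition7p6 : (n : ℕ) (w : Permutation′ n) →
    (∃ λ (f : Factorization n) → Represents n f w) ×
    (∀ (f : Factorization n) → Represents n f w →
      (occurrences 2 (factWord n f) ≡ almLRminA (w ⟨$⟩ˡ_)) ×
      (occurrences 2 (factWord n f) ≡ almLRminB (w ⟨$⟩ˡ_)) ×
      (occurrences 2 (factWord n f) ≡ almLRminA (w ⟨$⟩ʳ_)) ×
      (occurrences 2 (factWord n f) ≡ almLRminB (w ⟨$⟩ʳ_)))
proposition7p6 n w = factorization-exists n w , λ f rep →
  let occ≡ = occurrences-2-factWord n w f rep in
  occ≡ ,
  trans occ≡ (sym (trans (almLRminB-inverse (flip w)) (almLRminA-inverse w))) ,
  trans occ≡ (sym (almLRminA-inverse w)) ,
  trans occ≡ (sym (almLRminB-inverse w))
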